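{- For every finite simple graph $G$, the edge-biclique hypergraph $\mathcal{EB}(G)$ is Helly if and only if the clique hypergraph $\mathcal{K}(L_G)$ of the biclique line graph $L_G$ is Helly.
   Context: A biclique of $G$ is a vertex set $B\subseteq V(G)$ such that $G[B]$ is a complete bipartite graph and $B$ is inclusion-wise maximal with this property. The edge-biclique hypergraph $\mathcal{EB}(G)$ has vertex set $E(G)$ and its hyperedges are the edge sets $E(G[B])$ of the bicliques $B$ of $G$. The biclique line graph $L_G$ has vertex set $E(G)$, two edges of $G$ being adjacent iff they are both edges of $G[B]$ for some biclique $B$ of $G$. The clique hypergraph $\mathcal{K}(H)$ of a graph $H$ has vertex set $V(H)$ and its hyperedges are the cliques (inclusion-wise maximal complete vertex sets) of $H$. A hypergraph is Helly if every subfamily of pairwise intersecting hyperedges has a nonempty common intersection. -}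

module Defs where

open import Level using (Level) renaming (suc to lsuc; zero to lzero)
open import Data.Bool using (Bool; true; false; T)
open import Data.Nat using (ℕ)
open import Data.Fin using (Fin) renaming (_<_ to _<ᶠ_)
open import Data.Fin.Subset using (Subset; _∈_; _⊆_)
open import Data.Product using (Σ; ∃; _×_; _,_)
open import Data.List using (List; [])
open import Data.List.Relation.Unary.All using (All)
open import Relation.Binary.PropositionalEquality using (_≡_; _≢_)
open import Relation.Nullary using (¬_)
open import Data.Empty using (⊥)
import Level
open import Function.Bundles using (_⇔_)
open import Data.Sum using (_⊎_)

record Graph : Set where
  field
    n     : ℕ
    adj   : Fin n → Fin n → Bool
    sym   : ∀ i j → adj i j ≡ adj j i
    irrefl : ∀ i → adj i i ≡ false

  V : Set
  V = Fin n

  Adj : V → V → Set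
  Adj i j = T (adj i j)

  -- an edge {u,v}, represented canonically with u < v
  record Edge : Set where
    constructor edge
    field
      u   : V
      v   : V
      u<v : u <ᶠ v
      uv  : Adj u v

  open Edge public

  SameEdge : Edge → Edge → Set
  SameEdge e f = (u e ≡ u f) × (v e ≡ v f)

  IsCompleteBipartite : Subset n → Set
  IsCompleteBipartite B =
    Σ (Subset n) λ X → Σ (Subset n) λ Y →
        (∀ w → (w ∈ B) ⇔ (w ∈ X ⊎ w ∈ Y))
      × (∀ w → w ∈ X → w ∈ Y → ⊥)
      × (∃ λ x → x ∈ X) × (∃ λ y → y ∈ Y)
      × (∀ x x′ → x ∈ X → x′ ∈ X → ¬ Adj x x′)
      × (∀ y y′ → y ∈ Y → y′ ∈ Y → ¬ Adj y y′)
      × (∀ x y → x ∈ X → y ∈ Y → Adj x y)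

  IsBiclique : Subset n → Set
  IsBiclique B = IsCompleteBipartite B
               × (∀ B′ → B ⊆ B′ → IsCompleteBipartite B′ → B′ ⊆ B)

  EdgeIn : Subset n → Edge → Set
  EdgeIn B e = (u e ∈ B) × (v e ∈ B)

  -- Edge-biclique hypergraph EB(G): vertex set E(G); S is a hyperedge iff
  -- S = E(G[B]) for some biclique B.
  IsEBHyperedge : (Edge → Set) → Set
  IsEBHyperedge S = Σ (Subset n) λ B → IsBiclique B × (∀ e → S e ⇔ EdgeIn B e)

  -- Biclique line graph L_G: vertex set E(G); distinct e, f adjacent iff
  -- both are edges of G[B] for some biclique B.
  LAdj : Edge → Edge → Set
  LAdj e f = ¬ SameEdge e f × (Σ (Subset n) λ B → IsBiclique B × EdgeIn B e × EdgeIn B f)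

  IsCompleteL : (Edge → Set) → Set
  IsCompleteL S = ∀ e f → S e → S f → ¬ SameEdge e f → LAdj e f

  IsCliqueL : (Edge → Set) → Set₁
  IsCliqueL S = (∃ λ e → S e) × IsCompleteL S
              × (∀ (S′ : Edge → Set) → (∀ e → S e → S′ e) → IsCompleteL S′ → ∀ e → S′ e → S e)

-- Helly property of a hypergraph with vertex type V whose hyperedges are the
-- vertex sets S with H S: every nonempty (finite) subfamily of pairwise
-- intersecting hyperedges has a common vertex.

IsHelly : {ℓ : Level} {V : Set} → ((V → Set) → Set ℓ) → Set (lsuc lzero Level.⊔ ℓ)
IsHelly {V = V} H =
  ∀ (Fs : List (V → Set)) → Fs ≢ [] → All H Fs →
  All (λ S → All (λ S′ → ∃ λ x → S x × S′ x) Fs) Fs →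
  ∃ λ x → All (λ S → S x) Fs

EBHelly : Graph → Set₁
EBHelly G = IsHelly (Graph.IsEBHyperedge G)

KLHelly : Graph → Set₁
KLHelly G = IsHelly (Graph.IsCliqueL G)

module Submission where

-- Inside a complete bipartite set, adj x y is the xor of the side labels of x and y.  Hence a
-- vertex set W induces a complete bipartite graph iff it contains an edge and
-- adj x y = adj x r xor adj y r for all x, y ∈ W and some fixed r ∈ W (the sides are then the
-- non-neighbours and the neighbours of r).
--
-- (1) The edge set of a biclique B is a clique of L_G: if an edge f lies in a common biclique with
-- every edge of G[B], then B ∪ f still satisfies the parity condition, so f ⊆ B by maximality.
-- Thus every hyperedge of EB(G) is a hyperedge of K(L_G), and Helly passes from K(L_G) to EB(G).
--
-- (2) If EB(G) is Helly, edges that pairwise lie in common bicliques all lie in one biclique.  For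
-- e, f and a nonempty rest M, take bicliques containing e ∷ M, f ∷ M and {e, f}; they pairwise
-- share an edge, so by Helly some edge h lies in all three.  The vertices lying in at least two of
-- the three bicliques form a complete bipartite set: two such vertices share one of the bicliques,
-- which also contains h, so the parity condition holds with r an end of h.
--
-- For pairwise intersecting cliques C_i of L_G pick a_ij ∈ C_i ∩ C_j.  The bicliques containing
-- all a_ij and a_ji for one i pairwise intersect, so by Helly they share an edge h; by (2) every
-- f ∈ C_i lies in such a biclique, hence with h, and h ∈ C_i by maximality of C_i.

open import Defs
open import Data.Product using (_×_)

open import Data.Bool using (Bool; true; false; T; _xor_)
open import Data.Bool.Properties using (xor-comm; xor-same; xor-identityʳ; ¬-not; T-≡)
  renaming (_≟_ to _≟ᵇ_)
open import Data.Nat using (zero; suc)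
open import Data.Fin using (Fin; zero)
open import Data.Fin.Properties using (any?; all?; <-cmp) renaming (_≟_ to _≟ᶠ_)
open import Data.Fin.Subset using (Subset; _∈_; _⊆_; ⁅_⁆; _∪_; _∩_; ∁)
open import Data.Fin.Subset.Properties
  using (_∈?_; x∈⁅x⁆; x∈⁅y⁆⇒x≡y; x∈p∪q⁻; p⊆p∪q; q⊆p∪q; x∈p∩q⁺; x∈p∩q⁻; x∈∁p⇒x∉p; x∉p⇒x∈∁p)
import Data.Vec as Vec
open import Data.Vec.Properties using (lookup∘tabulate; []=⇒lookup; lookup⇒[]=)
open import Data.Product using (∃; ∃₂; _,_; proj₁; proj₂; swap; uncurry)
open import Data.Sum using (_⊎_; inj₁; inj₂; [_,_])
import Data.Sum as Sum
open import Data.Empty using (⊥; ⊥-elim)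
open import Relation.Nullary using (¬_; Dec; yes; no; contradiction)
open import Relation.Nullary.Decidable using (_×-dec_; _⊎-dec_; _→-dec_; ¬?; T?)
  renaming (map to mapDec)
open import Relation.Unary using (Decidable)
open import Relation.Binary using (tri<; tri≈; tri>)
open import Relation.Binary.PropositionalEquality
  using (_≡_; _≢_; refl; sym; trans; cong; cong₂; subst)
open import Function using (id; _∘_; flip; case_of_)
open import Function.Bundles using (_⇔_; mk⇔; Equivalence)
open import Data.List using (List; []; _∷_; map; _++_; filter; lookup; tabulate; allFin)
open import Data.List.Properties using (tabulate-lookup)
open import Data.List.Relation.Unary.All as All using (All; []; _∷_)
open import Data.List.Relation.Unary.All.Properties using (map⁺; map⁻; ++⁺; tabulate⁺; all-filter)
open import Data.List.Relation.Unary.AllPairs as AllPairs using (AllPairs; []; _∷_)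
open import Data.List.Relation.Unary.Any using (here; there)
open import Data.List.Membership.Propositional using () renaming (_∈_ to _∈ₗ_)
open import Data.List.Membership.Propositional.Properties
  using (∈-lookup; ∈-filter⁺; ∈-map⁺; ∈-++⁺ˡ; ∈-++⁺ʳ; ∈-tabulate⁺; ∈-allFin)

xor-via : ∀ a b c → a xor b ≡ (a xor c) xor (b xor c)
xor-via true  true  true  = refl
xor-via true  true  false = refl
xor-via true  false true  = refl
xor-via true  false false = refl
xor-via false true  true  = refl
xor-via false true  false = refl
xor-via false false true  = refl
xor-via false false false = refl

¬T⇒≡false : ∀ {b} → ¬ T b → b ≡ false
¬T⇒≡false {true}  ¬t = ⊥-elim (¬t _)
¬T⇒≡false {false} _  = refl

≡false⇒¬T : ∀ {b} → b ≡ false → ¬ T b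
≡false⇒¬T refl ()

TwoOf : {A : Set} (P Q R : A → Set) → A → Set
TwoOf P Q R x = (P x × Q x) ⊎ (P x × R x) ⊎ (Q x × R x)

twoOf-pigeonhole : ∀ {A : Set} {P Q R : A → Set} {x y} → TwoOf P Q R x → TwoOf P Q R y →
                   (P x × P y) ⊎ (Q x × Q y) ⊎ (R x × R y)
twoOf-pigeonhole (inj₁ (px , _))        (inj₁ (py , _))        = inj₁ (px , py)
twoOf-pigeonhole (inj₁ (px , _))        (inj₂ (inj₁ (py , _))) = inj₁ (px , py)
twoOf-pigeonhole (inj₁ (_ , qx))        (inj₂ (inj₂ (qy , _))) = inj₂ (inj₁ (qx , qy))
twoOf-pigeonhole (inj₂ (inj₁ (px , _))) (inj₁ (py , _))        = inj₁ (px , py)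
twoOf-pigeonhole (inj₂ (inj₁ (px , _))) (inj₂ (inj₁ (py , _))) = inj₁ (px , py)
twoOf-pigeonhole (inj₂ (inj₁ (_ , rx))) (inj₂ (inj₂ (_ , ry))) = inj₂ (inj₂ (rx , ry))
twoOf-pigeonhole (inj₂ (inj₂ (qx , _))) (inj₁ (_ , qy))        = inj₂ (inj₁ (qx , qy))
twoOf-pigeonhole (inj₂ (inj₂ (_ , rx))) (inj₂ (inj₁ (_ , ry))) = inj₂ (inj₂ (rx , ry))
twoOf-pigeonhole (inj₂ (inj₂ (qx , _))) (inj₂ (inj₂ (qy , _))) = inj₂ (inj₁ (qx , qy))

all⇒allPairs : ∀ {A : Set} {P : A → Set} {R : A → A → Set} →
               (∀ {x y} → P x → P y → R x y) → ∀ {xs} → All P xs → AllPairs R xs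
all⇒allPairs r []         = []
all⇒allPairs r (px ∷ pxs) = All.map (r px) pxs ∷ all⇒allPairs r pxs

∈⇒≢[] : ∀ {A : Set} {x : A} {xs} → x ∈ₗ xs → xs ≢ []
∈⇒≢[] (here _)  ()
∈⇒≢[] (there _) ()

∈-tabulate⇔ : ∀ {n} (f : Fin n → Bool) {x} → x ∈ Vec.tabulate f ⇔ f x ≡ true
∈-tabulate⇔ f {x} = mk⇔ (λ m → trans (sym (lookup∘tabulate f x)) ([]=⇒lookup m))
                        (λ eq → lookup⇒[]= x _ (trans (lookup∘tabulate f x) eq))

∪-⊆ : ∀ {n} {p q r : Subset n} → p ⊆ r → q ⊆ r → p ∪ q ⊆ r
∪-⊆ {p = p} {q} p⊆r q⊆r m = [ p⊆r , q⊆r ] (x∈p∪q⁻ p q m)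

⁅⁆-⊆ : ∀ {n} {x : Fin n} {p} → x ∈ p → ⁅ x ⁆ ⊆ p
⁅⁆-⊆ {x = x} {p} x∈p m = subst (_∈ p) (sym (x∈⁅y⁆⇒x≡y x m)) x∈p

allSubsets : ∀ n → List (Subset n)
allSubsets zero    = Vec.[] ∷ []
allSubsets (suc n) = map (true Vec.∷_) (allSubsets n) ++ map (false Vec.∷_) (allSubsets n)

∈-allSubsets : ∀ {n} (p : Subset n) → p ∈ₗ allSubsets n
∈-allSubsets Vec.[]                   = here refl
∈-allSubsets (true Vec.∷ p)           = ∈-++⁺ˡ (∈-map⁺ (true Vec.∷_) (∈-allSubsets p))
∈-allSubsets {suc n} (false Vec.∷ p) =
  ∈-++⁺ʳ (map (true Vec.∷_) (allSubsets n)) (∈-map⁺ (false Vec.∷_) (∈-allSubsets p))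

module _ (G : Graph) where
  open Graph G renaming (sym to adj-sym)

  variable
    a b c p q r x y z : V
    B B′ S S′ S₁ S₂ S₃ W W′ : Subset n
    e f g h : Edge
    es : List Edge

  adj-sym′ : Adj x y → Adj y x
  adj-sym′ {x = x} {y = y} = subst T (adj-sym x y)

  loopless : ∀ x → ¬ Adj x x
  loopless x = ≡false⇒¬T (irrefl x)

  -- Complete bipartite sets and the parity condition

  Parity : V → V → V → Set
  Parity x y z = adj x y ≡ adj x z xor adj y z

  ParityAt : Subset n → V → Set
  ParityAt W r = ∀ {x y} → x ∈ W → y ∈ W → Parity x y r

  ParityClosed : Subset n → Set
  ParityClosed W = ∀ x y z → x ∈ W → y ∈ W → z ∈ W → Parity x y z

  HasEdge : Subset n → Set
  HasEdge W = ∃₂ λ a b → a ∈ W × b ∈ W × Adj a b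

  parity-sym : Parity x y z → Parity y x z
  parity-sym {x = x} {y = y} {z = z} xyz = trans (adj-sym y x) (trans xyz (xor-comm (adj x z) (adj y z)))

  parity-rebase : Parity p q r → Parity p a r → Parity q a r → Parity p q a
  parity-rebase {p = p} {q = q} {r = r} {a = a} pqr par qar =
    trans pqr (trans (xor-via (adj p r) (adj q r) (adj a r)) (cong₂ _xor_ (sym par) (sym qar)))

  parity-diag : ∀ x z → Parity x x z
  parity-diag x z = trans (irrefl x) (sym (xor-same (adj x z)))

  parity-atˡ : ∀ x y → Parity x y x
  parity-atˡ x y = trans (adj-sym x y) (cong (_xor adj y x) (sym (irrefl x)))

  parity-atʳ : ∀ x y → Parity x y y
  parity-atʳ x y = sym (trans (cong (adj x y xor_) (irrefl y)) (xor-identityʳ (adj x y)))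

  parity⇒adjacent⊎adjacent : Parity p c a → Adj c a → Adj p a ⊎ Adj p c
  parity⇒adjacent⊎adjacent {p = p} {c = c} {a = a} pca ca with T? (adj p a)
  ... | yes pa = inj₁ pa
  ... | no ¬pa = inj₂ (subst T (sym (trans pca (cong (_xor adj c a) (¬T⇒≡false ¬pa)))) ca)

  completeBipartite⇒hasEdge : IsCompleteBipartite W → HasEdge W
  completeBipartite⇒hasEdge (X , Y , split , _ , (x , x∈X) , (y , y∈Y) , _ , _ , cross) =
    x , y , Equivalence.from (split x) (inj₁ x∈X) , Equivalence.from (split y) (inj₂ y∈Y) ,
    cross x y x∈X y∈Y

  completeBipartite⇒parity : IsCompleteBipartite W → x ∈ W → y ∈ W → z ∈ W → Parity x y z
  completeBipartite⇒parity {x = x} {y = y} {z = z} (X , Y , split , _ , _ , _ , indX , indY , cross)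
                           xW yW zW =
    trans (adj≡xor sx sy) (trans (xor-via (side sx) (side sy) (side sz))
      (cong₂ _xor_ (sym (adj≡xor sx sz)) (sym (adj≡xor sy sz))))
    where
      side : ∀ {p} → p ∈ X ⊎ p ∈ Y → Bool
      side (inj₁ _) = false
      side (inj₂ _) = true
      adj≡xor : ∀ {p q} (sp : p ∈ X ⊎ p ∈ Y) (sq : q ∈ X ⊎ q ∈ Y) → adj p q ≡ side sp xor side sq
      adj≡xor {p} {q} (inj₁ pX) (inj₁ qX) = ¬T⇒≡false (indX p q pX qX)
      adj≡xor {p} {q} (inj₁ pX) (inj₂ qY) = Equivalence.to T-≡ (cross p q pX qY)
      adj≡xor {p} {q} (inj₂ pY) (inj₁ qX) = Equivalence.to T-≡ (adj-sym′ (cross q p qX pY))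
      adj≡xor {p} {q} (inj₂ pY) (inj₂ qY) = ¬T⇒≡false (indY p q pY qY)
      sx : x ∈ X ⊎ x ∈ Y
      sx = Equivalence.to (split x) xW
      sy : y ∈ X ⊎ y ∈ Y
      sy = Equivalence.to (split y) yW
      sz : z ∈ X ⊎ z ∈ Y
      sz = Equivalence.to (split z) zW

  parityAt⇒completeBipartite : a ∈ W → b ∈ W → Adj a b → ParityAt W a → IsCompleteBipartite W
  parityAt⇒completeBipartite {a = a} {W = W} {b = b} aW bW ab par =
    X , Y , split , disjoint , (a , a∈X) , (b , b∈Y) , indX , indY , cross
    where
      N X Y : Subset n
      N = Vec.tabulate (λ x → adj x a)
      X = W ∩ ∁ N
      Y = W ∩ N
      inX : x ∈ X → x ∈ W × adj x a ≡ false
      inX m = let xW , x∈∁N = x∈p∩q⁻ W (∁ N) m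
              in xW , ¬-not (x∈∁p⇒x∉p x∈∁N ∘ Equivalence.from (∈-tabulate⇔ _))
      inY : x ∈ Y → x ∈ W × adj x a ≡ true
      inY m = let xW , x∈N = x∈p∩q⁻ W N m in xW , Equivalence.to (∈-tabulate⇔ _) x∈N
      adj≡ : ∀ {β γ} → x ∈ W × adj x a ≡ β → y ∈ W × adj y a ≡ γ → adj x y ≡ β xor γ
      adj≡ (xW , xa) (yW , ya) = trans (par xW yW) (cong₂ _xor_ xa ya)
      split : ∀ w → (w ∈ W) ⇔ (w ∈ X ⊎ w ∈ Y)
      split w = mk⇔ classify [ proj₁ ∘ inX , proj₁ ∘ inY ]
        where
          classify : w ∈ W → w ∈ X ⊎ w ∈ Y
          classify wW with w ∈? N
          ... | yes w∈N = inj₂ (x∈p∩q⁺ (wW , w∈N))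
          ... | no  w∉N = inj₁ (x∈p∩q⁺ (wW , x∉p⇒x∈∁p w∉N))
      disjoint : ∀ w → w ∈ X → w ∈ Y → ⊥
      disjoint w mX mY = x∈∁p⇒x∉p (proj₂ (x∈p∩q⁻ W (∁ N) mX)) (proj₂ (x∈p∩q⁻ W N mY))
      a∈X : a ∈ X
      a∈X = x∈p∩q⁺ (aW , x∉p⇒x∈∁p (loopless a ∘ Equivalence.from T-≡ ∘ Equivalence.to (∈-tabulate⇔ _)))
      b∈Y : b ∈ Y
      b∈Y = x∈p∩q⁺ (bW , Equivalence.from (∈-tabulate⇔ _) (Equivalence.to T-≡ (adj-sym′ ab)))
      indX : ∀ x x′ → x ∈ X → x′ ∈ X → ¬ Adj x x′
      indX _ _ mx mx′ = ≡false⇒¬T (adj≡ (inX mx) (inX mx′))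
      indY : ∀ y y′ → y ∈ Y → y′ ∈ Y → ¬ Adj y y′
      indY _ _ my my′ = ≡false⇒¬T (adj≡ (inY my) (inY my′))
      cross : ∀ x y → x ∈ X → y ∈ Y → Adj x y
      cross _ _ mx my = Equivalence.from T-≡ (adj≡ (inX mx) (inY my))

  hasEdge×parityClosed⇔completeBipartite : (HasEdge W × ParityClosed W) ⇔ IsCompleteBipartite W
  hasEdge×parityClosed⇔completeBipartite = mk⇔
    (λ ((a , b , aW , bW , ab) , closed) →
       parityAt⇒completeBipartite aW bW ab (λ xW yW → closed _ _ _ xW yW aW))
    (λ cb → completeBipartite⇒hasEdge cb , λ _ _ _ → completeBipartite⇒parity cb)

  completeBipartite? : Decidable IsCompleteBipartite
  completeBipartite? W = mapDec hasEdge×parityClosed⇔completeBipartite (hasEdge? ×-dec parityClosed?)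
    where
      hasEdge? : Dec (HasEdge W)
      hasEdge? = any? λ a → any? λ b → (a ∈? W) ×-dec (b ∈? W) ×-dec T? (adj a b)
      parityClosed? : Dec (ParityClosed W)
      parityClosed? = all? λ x → all? λ y → all? λ z →
        (x ∈? W) →-dec (y ∈? W) →-dec (z ∈? W) →-dec (adj x y ≟ᵇ (adj x z xor adj y z))

  completeBipartite-⊆ : W′ ⊆ W → IsCompleteBipartite W → HasEdge W′ → IsCompleteBipartite W′
  completeBipartite-⊆ W′⊆W cb edge′ = Equivalence.to hasEdge×parityClosed⇔completeBipartite
    (edge′ , λ _ _ _ xW yW zW → completeBipartite⇒parity cb (W′⊆W xW) (W′⊆W yW) (W′⊆W zW))

  hasEdge-⊆ : W ⊆ W′ → HasEdge W → HasEdge W′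
  hasEdge-⊆ W⊆W′ (a , b , aW , bW , ab) = a , b , W⊆W′ aW , W⊆W′ bW , ab

  OneStepMaximal : Subset n → Set
  OneStepMaximal B = ∀ w → w ∈ B ⊎ ¬ IsCompleteBipartite (B ∪ ⁅ w ⁆)

  oneStepMaximal⇒biclique : IsCompleteBipartite B → OneStepMaximal B → IsBiclique B
  oneStepMaximal⇒biclique cb maximal = cb , λ B′ B⊆B′ cb′ {w} wB′ →
    [ id , contradiction (completeBipartite-⊆ (∪-⊆ B⊆B′ (⁅⁆-⊆ wB′)) cb′
                            (hasEdge-⊆ (p⊆p∪q _) (completeBipartite⇒hasEdge cb))) ] (maximal w)

  biclique⇒oneStepMaximal : IsBiclique B → OneStepMaximal B
  biclique⇒oneStepMaximal {B = B} (_ , maximal) w with w ∈? B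
  ... | yes wB = inj₁ wB
  ... | no  w∉B = inj₂ λ cb → w∉B (maximal (B ∪ ⁅ w ⁆) (p⊆p∪q _) cb (q⊆p∪q B _ (x∈⁅x⁆ w)))

  biclique? : Decidable IsBiclique
  biclique? B = mapDec
    (mk⇔ (uncurry oneStepMaximal⇒biclique) (λ bic → proj₁ bic , biclique⇒oneStepMaximal bic))
    (completeBipartite? B ×-dec all? λ w → (w ∈? B) ⊎-dec ¬? (completeBipartite? (B ∪ ⁅ w ⁆)))

  grow : List V → Subset n → Subset n
  grow []       W = W
  grow (w ∷ ws) W with completeBipartite? (W ∪ ⁅ w ⁆)
  ... | yes _ = grow ws (W ∪ ⁅ w ⁆)
  ... | no  _ = grow ws W

  grow-⊇ : ∀ ws W → W ⊆ grow ws W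
  grow-⊇ []       W m = m
  grow-⊇ (w ∷ ws) W m with completeBipartite? (W ∪ ⁅ w ⁆)
  ... | yes _ = grow-⊇ ws _ (p⊆p∪q _ m)
  ... | no  _ = grow-⊇ ws W m

  grow-completeBipartite : ∀ ws → IsCompleteBipartite W → IsCompleteBipartite (grow ws W)
  grow-completeBipartite []       cb = cb
  grow-completeBipartite {W = W} (w ∷ ws) cb with completeBipartite? (W ∪ ⁅ w ⁆)
  ... | yes cb′ = grow-completeBipartite ws cb′
  ... | no  _   = grow-completeBipartite ws cb

  grow-maximal : ∀ ws → IsCompleteBipartite W → ∀ {w} → w ∈ₗ ws →
                 w ∈ grow ws W ⊎ ¬ IsCompleteBipartite (grow ws W ∪ ⁅ w ⁆)
  grow-maximal {W = W} (w ∷ ws) cb (here refl) with completeBipartite? (W ∪ ⁅ w ⁆)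
  ... | yes _   = inj₁ (grow-⊇ ws _ (q⊆p∪q W _ (x∈⁅x⁆ w)))
  ... | no  ¬cb = inj₂ λ cb′ →
    ¬cb (completeBipartite-⊆ (∪-⊆ (p⊆p∪q _ ∘ grow-⊇ ws W) (q⊆p∪q _ _)) cb′
                             (hasEdge-⊆ (p⊆p∪q _) (completeBipartite⇒hasEdge cb)))
  grow-maximal {W = W} (w′ ∷ ws) cb (there m) with completeBipartite? (W ∪ ⁅ w′ ⁆)
  ... | yes cb′ = grow-maximal ws cb′ m
  ... | no  _   = grow-maximal ws cb m

  completeBipartite⇒⊆biclique : ∀ W → IsCompleteBipartite W → ∃ λ B → IsBiclique B × W ⊆ B
  completeBipartite⇒⊆biclique W cb =
    grow (allFin n) W ,
    oneStepMaximal⇒biclique (grow-completeBipartite (allFin n) cb)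
                            (λ w → grow-maximal (allFin n) cb (∈-allFin w)) ,
    grow-⊇ (allFin n) W

  edgeOf : ∀ x y → Adj x y → Edge
  edgeOf x y xy with <-cmp x y
  ... | tri< x<y _ _  = edge x y x<y xy
  ... | tri≈ _ refl _ = contradiction xy (loopless x)
  ... | tri> _ _ y<x  = edge y x y<x (adj-sym′ xy)

  edgeIn-edgeOf : ∀ S x y (xy : Adj x y) → EdgeIn S (edgeOf x y xy) ⇔ (x ∈ S × y ∈ S)
  edgeIn-edgeOf S x y xy with <-cmp x y
  ... | tri< _ _ _    = mk⇔ id id
  ... | tri≈ _ refl _ = contradiction xy (loopless x)
  ... | tri> _ _ _    = mk⇔ swap swap

  edgeIn? : ∀ B e → Dec (EdgeIn B e)
  edgeIn? B e = (u e ∈? B) ×-dec (v e ∈? B)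

  edgeIn-⊆ : S ⊆ S′ → EdgeIn S e → EdgeIn S′ e
  edgeIn-⊆ S⊆S′ (uS , vS) = S⊆S′ uS , S⊆S′ vS

  ends : Edge → Subset n
  ends e = ⁅ u e ⁆ ∪ ⁅ v e ⁆

  u∈ends : ∀ e → u e ∈ ends e
  u∈ends e = p⊆p∪q _ (x∈⁅x⁆ (u e))

  v∈ends : ∀ e → v e ∈ ends e
  v∈ends e = q⊆p∪q _ _ (x∈⁅x⁆ (v e))

  ends⊆⇔edgeIn : ∀ e → ends e ⊆ S ⇔ EdgeIn S e
  ends⊆⇔edgeIn e = mk⇔ (λ ends⊆S → ends⊆S (u∈ends e) , ends⊆S (v∈ends e))
                        (λ (uS , vS) {_} → ∪-⊆ (⁅⁆-⊆ uS) (⁅⁆-⊆ vS))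

  ends-completeBipartite : ∀ e → IsCompleteBipartite (ends e)
  ends-completeBipartite e = parityAt⇒completeBipartite (u∈ends e) (v∈ends e) (uv e) parity
    where
      endpoint : x ∈ ends e → x ≡ u e ⊎ x ≡ v e
      endpoint m = Sum.map (x∈⁅y⁆⇒x≡y _) (x∈⁅y⁆⇒x≡y _) (x∈p∪q⁻ _ _ m)
      parity : ParityAt (ends e) (u e)
      parity xe ye with endpoint xe | endpoint ye
      ... | inj₁ refl | inj₁ refl = parity-diag _ _
      ... | inj₁ refl | inj₂ refl = parity-atˡ _ _
      ... | inj₂ refl | inj₁ refl = parity-atʳ _ _
      ... | inj₂ refl | inj₂ refl = parity-diag _ _

  edge⊆biclique : ∀ e → ∃ λ B → IsBiclique B × EdgeIn B e
  edge⊆biclique e =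
    let B , bic , ends⊆B = completeBipartite⇒⊆biclique (ends e) (ends-completeBipartite e)
    in B , bic , Equivalence.to (ends⊆⇔edgeIn e) ends⊆B

  Cobiclique : Edge → Edge → Set
  Cobiclique e f = ∃ λ B → IsBiclique B × EdgeIn B e × EdgeIn B f

  sameEdge? : ∀ e f → Dec (SameEdge e f)
  sameEdge? e f = (u e ≟ᶠ u f) ×-dec (v e ≟ᶠ v f)

  sameEdge⇒cobiclique : SameEdge e f → Cobiclique e f
  sameEdge⇒cobiclique {e = e} (refl , refl) = let B , bic , eB = edge⊆biclique e in B , bic , eB , eB

  -- Cliques of the biclique line graph

  complete⇒cobiclique : ∀ {C} → IsCompleteL C → C e → C f → Cobiclique e f
  complete⇒cobiclique {e = e} {f = f} complete ce cf with sameEdge? e f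
  ... | yes same  = sameEdge⇒cobiclique {e = e} {f = f} same
  ... | no  ¬same = proj₂ (complete e f ce cf ¬same)

  clique-absorbs : ∀ {C} → IsCliqueL C → (∀ {f} → C f → ¬ SameEdge f h → LAdj f h) → C h
  clique-absorbs {h = h} {C = C} (_ , complete , maximal) adjacent =
    maximal C′ (λ _ → inj₁) complete′ h (inj₂ refl)
    where
      C′ : Edge → Set
      C′ x = C x ⊎ x ≡ h
      complete′ : IsCompleteL C′
      complete′ e f (inj₁ ce)   (inj₁ cf)   ¬same = complete e f ce cf ¬same
      complete′ e f (inj₁ ce)   (inj₂ refl) ¬same = adjacent ce ¬same
      complete′ e f (inj₂ refl) (inj₁ cf)   ¬same =
        let _ , B , bic , fB , hB = adjacent cf λ (uu , vv) → ¬same (sym uu , sym vv)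
        in ¬same , B , bic , hB , fB
      complete′ e f (inj₂ refl) (inj₂ refl) ¬same = contradiction (refl , refl) ¬same

  completeBipartite⇒edgeIn : IsCompleteBipartite B → ∃ λ e → EdgeIn B e
  completeBipartite⇒edgeIn {B = B} cb =
    let a , c , aB , cB , ac = completeBipartite⇒hasEdge cb
    in edgeOf a c ac , Equivalence.from (edgeIn-edgeOf B a c ac) (aB , cB)

  ∪ends-completeBipartite : ∀ f → IsCompleteBipartite B → (∀ {g} → EdgeIn B g → Cobiclique g f) →
                            IsCompleteBipartite (B ∪ ends f)
  ∪ends-completeBipartite {B = B} f cb cob = absorb (completeBipartite⇒hasEdge cb)
    where
      withF : ∀ p r → Adj p r → p ∈ B → r ∈ B →
              ∃ λ S → IsCompleteBipartite S × (p ∈ S × r ∈ S) × ends f ⊆ S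
      withF p r pr pB rB =
        let S , (cbS , _) , prS , fS =
              cob {edgeOf p r pr} (Equivalence.from (edgeIn-edgeOf B p r pr) (pB , rB))
        in S , cbS , Equivalence.to (edgeIn-edgeOf S p r pr) prS , Equivalence.from (ends⊆⇔edgeIn f) fS
      parityVia : Adj p r → p ∈ B → r ∈ B → q ∈ ends f → Parity p q r
      parityVia {p = p} {r = r} pr pB rB qf =
        let S , cbS , (pS , rS) , fS = withF p r pr pB rB
        in completeBipartite⇒parity cbS pS (fS qf) rS
      absorb : HasEdge B → IsCompleteBipartite (B ∪ ends f)
      absorb (a , c , aB , cB , ac) = parityAt⇒completeBipartite (p⊆p∪q _ aB) (p⊆p∪q _ cB) ac parity
        where
          -- every p ∈ B is adjacent to a or to c; in the second case change the reference vertex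
          parityBF : p ∈ B → q ∈ ends f → Parity p q a
          parityBF pB qf with parity⇒adjacent⊎adjacent (completeBipartite⇒parity cb pB cB aB) (adj-sym′ ac)
          ... | inj₁ pa = parityVia pa pB aB qf
          ... | inj₂ pc = parity-rebase (parityVia pc pB cB qf) (completeBipartite⇒parity cb pB aB cB)
                                        (parity-sym (parityVia ac aB cB qf))
          parity : ParityAt (B ∪ ends f) a
          parity xW yW with x∈p∪q⁻ B (ends f) xW | x∈p∪q⁻ B (ends f) yW
          ... | inj₁ xB | inj₁ yB = completeBipartite⇒parity cb xB yB aB
          ... | inj₁ xB | inj₂ yf = parityBF xB yf
          ... | inj₂ xf | inj₁ yB = parity-sym (parityBF yB xf)
          ... | inj₂ xf | inj₂ yf =
            let S , cbS , (aS , _) , fS = withF a c ac aB cB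
            in completeBipartite⇒parity cbS (fS xf) (fS yf) aS

  biclique⇒clique : IsBiclique B → IsCliqueL (EdgeIn B)
  biclique⇒clique {B = B} bic@(cb , maximal) =
    completeBipartite⇒edgeIn cb ,
    (λ e f eB fB ¬same → ¬same , B , bic , eB , fB) ,
    λ C′ B⊆C′ complete′ f c′f → Equivalence.to (ends⊆⇔edgeIn f) λ m →
      maximal (B ∪ ends f) (p⊆p∪q _)
        (∪ends-completeBipartite f cb λ {g} gB → complete⇒cobiclique complete′ (B⊆C′ g gB) c′f)
        (q⊆p∪q B _ m)

  ebHyperedge⇒clique : ∀ {C} → IsEBHyperedge C → IsCliqueL C
  ebHyperedge⇒clique {C = C} (B , bic , C⇔B) =
    let (e , eB) , complete , maximal = biclique⇒clique bic
    in (e , from eB) ,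
       (λ e f ce cf → complete e f (to ce) (to cf)) ,
       (λ C′ C⊆C′ complete′ e c′e → from (maximal C′ (λ e → C⊆C′ e ∘ from) complete′ e c′e))
    where
      to : C e → EdgeIn B e
      to {e = e} = Equivalence.to (C⇔B e)
      from : EdgeIn B e → C e
      from {e = e} = Equivalence.from (C⇔B e)

  majority : Subset n → Subset n → Subset n → Subset n
  majority S₁ S₂ S₃ = S₁ ∩ S₂ ∪ S₁ ∩ S₃ ∪ S₂ ∩ S₃

  majority⁺ : TwoOf (_∈ S₁) (_∈ S₂) (_∈ S₃) x → x ∈ majority S₁ S₂ S₃
  majority⁺ (inj₁ m)        = p⊆p∪q _ (x∈p∩q⁺ m)
  majority⁺ (inj₂ (inj₁ m)) = q⊆p∪q _ _ (p⊆p∪q _ (x∈p∩q⁺ m))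
  majority⁺ (inj₂ (inj₂ m)) = q⊆p∪q _ _ (q⊆p∪q _ _ (x∈p∩q⁺ m))

  majority⁻ : x ∈ majority S₁ S₂ S₃ → TwoOf (_∈ S₁) (_∈ S₂) (_∈ S₃) x
  majority⁻ {S₁ = S₁} {S₂ = S₂} {S₃ = S₃} m =
    Sum.map (x∈p∩q⁻ S₁ S₂) (Sum.map (x∈p∩q⁻ S₁ S₃) (x∈p∩q⁻ S₂ S₃) ∘ x∈p∪q⁻ _ _) (x∈p∪q⁻ _ _ m)

  edgeIn-majority : TwoOf (EdgeIn S₁) (EdgeIn S₂) (EdgeIn S₃) e → EdgeIn (majority S₁ S₂ S₃) e
  edgeIn-majority (inj₁ ((u₁ , v₁) , (u₂ , v₂))) =
    majority⁺ (inj₁ (u₁ , u₂)) , majority⁺ (inj₁ (v₁ , v₂))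
  edgeIn-majority (inj₂ (inj₁ ((u₁ , v₁) , (u₃ , v₃)))) =
    majority⁺ (inj₂ (inj₁ (u₁ , u₃))) , majority⁺ (inj₂ (inj₁ (v₁ , v₃)))
  edgeIn-majority (inj₂ (inj₂ ((u₂ , v₂) , (u₃ , v₃)))) =
    majority⁺ (inj₂ (inj₂ (u₂ , u₃))) , majority⁺ (inj₂ (inj₂ (v₂ , v₃)))

  majority-completeBipartite : ∀ h →
    IsCompleteBipartite S₁ → IsCompleteBipartite S₂ → IsCompleteBipartite S₃ →
    EdgeIn S₁ h → EdgeIn S₂ h → EdgeIn S₃ h → IsCompleteBipartite (majority S₁ S₂ S₃)
  majority-completeBipartite {S₁ = S₁} {S₂ = S₂} {S₃ = S₃} h cb₁ cb₂ cb₃ (u₁ , v₁) (u₂ , v₂) (u₃ , v₃) =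
    parityAt⇒completeBipartite (majority⁺ (inj₁ (u₁ , u₂))) (majority⁺ (inj₁ (v₁ , v₂))) (uv h) parity
    where
      parity : ParityAt (majority S₁ S₂ S₃) (u h)
      parity xM yM with twoOf-pigeonhole {P = _∈ S₁} {_∈ S₂} {_∈ S₃} (majority⁻ xM) (majority⁻ yM)
      ... | inj₁ (x₁ , y₁)        = completeBipartite⇒parity cb₁ x₁ y₁ u₁
      ... | inj₂ (inj₁ (x₂ , y₂)) = completeBipartite⇒parity cb₂ x₂ y₂ u₂
      ... | inj₂ (inj₂ (x₃ , y₃)) = completeBipartite⇒parity cb₃ x₃ y₃ u₃

  -- Consequences of the Helly property of EB(G)

  Meet : Subset n → Subset n → Set
  Meet B B′ = ∃ λ e → EdgeIn B e × EdgeIn B′ e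

  meet-self : Meet B B′ → Meet B B
  meet-self (e , eB , _) = e , eB , eB

  meet-sym : Meet B B′ → Meet B′ B
  meet-sym (e , eB , eB′) = e , eB′ , eB

  InBiclique : List Edge → Set
  InBiclique es = ∃ λ B → IsBiclique B × All (EdgeIn B) es

  module _ (ebHelly : EBHelly G) where

    helly-bicliques : ∀ Bs → Bs ≢ [] → All IsBiclique Bs → All (λ B → All (Meet B) Bs) Bs →
                      ∃ λ e → All (λ B → EdgeIn B e) Bs
    helly-bicliques []          ne _    _     = contradiction refl ne
    helly-bicliques Bs@(_ ∷ _) _  bics meets =
      let e , common = ebHelly (map EdgeIn Bs) (λ ())
                         (map⁺ (All.map (λ bic → _ , bic , λ _ → mk⇔ id id) bics))
                         (map⁺ (All.map (map⁺ {f = EdgeIn}) meets))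
      in e , map⁻ common

    helly₃ : IsBiclique S₁ → IsBiclique S₂ → IsBiclique S₃ →
             Meet S₁ S₂ → Meet S₁ S₃ → Meet S₂ S₃ → ∃ λ h → EdgeIn S₁ h × EdgeIn S₂ h × EdgeIn S₃ h
    helly₃ {S₁ = S₁} {S₂ = S₂} {S₃ = S₃} b₁ b₂ b₃ m₁₂ m₁₃ m₂₃ =
      case helly-bicliques (S₁ ∷ S₂ ∷ S₃ ∷ []) (λ ()) (b₁ ∷ b₂ ∷ b₃ ∷ [])
             ((meet-self m₁₂ ∷ m₁₂ ∷ m₁₃ ∷ []) ∷
              (meet-sym m₁₂ ∷ meet-self m₂₃ ∷ m₂₃ ∷ []) ∷
              (meet-sym m₁₃ ∷ meet-sym m₂₃ ∷ meet-self (meet-sym m₂₃) ∷ []) ∷ [])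
      of λ { (h , h₁ ∷ h₂ ∷ h₃ ∷ []) → h , h₁ , h₂ , h₃ }

    inBiclique-merge : Cobiclique e f → InBiclique (e ∷ g ∷ es) → InBiclique (f ∷ g ∷ es) →
                       InBiclique (e ∷ f ∷ g ∷ es)
    inBiclique-merge {e = e} {f = f} {g = g}
                     (B₁ , b₁ , e₁ , f₁) (B₂ , b₂ , e₂ ∷ g₂ ∷ es₂) (B₃ , b₃ , f₃ ∷ g₃ ∷ es₃) =
      let h , h₁ , h₂ , h₃ = helly₃ b₁ b₂ b₃ (e , e₁ , e₂) (f , f₁ , f₃) (g , g₂ , g₃)
          B , bic , majority⊆B =
            completeBipartite⇒⊆biclique (majority B₁ B₂ B₃)
              (majority-completeBipartite h (proj₁ b₁) (proj₁ b₂) (proj₁ b₃) h₁ h₂ h₃)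
          into : ∀ g → TwoOf (EdgeIn B₁) (EdgeIn B₂) (EdgeIn B₃) g → EdgeIn B g
          into g = edgeIn-⊆ {e = g} majority⊆B ∘ edgeIn-majority {S₁ = B₁} {S₂ = B₂} {S₃ = B₃} {e = g}
      in B , bic , into e (inj₁ (e₁ , e₂)) ∷ into f (inj₂ (inj₁ (f₁ , f₃))) ∷
                   All.zipWith (λ {g} → into g ∘ inj₂ ∘ inj₂) (g₂ ∷ es₂ , g₃ ∷ es₃)

    pairwiseCobiclique⇒inBiclique : ∀ e es → AllPairs Cobiclique (e ∷ es) → InBiclique (e ∷ es)
    pairwiseCobiclique⇒inBiclique e [] _ = let B , bic , eB = edge⊆biclique e in B , bic , eB ∷ []
    pairwiseCobiclique⇒inBiclique e (f ∷ []) (((B , bic , eB , fB) ∷ []) ∷ _) = B , bic , eB ∷ fB ∷ []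
    pairwiseCobiclique⇒inBiclique e (f ∷ g ∷ es) ((ef ∷ eg∷es) ∷ f∷g∷es) =
      inBiclique-merge ef (pairwiseCobiclique⇒inBiclique e (g ∷ es) (eg∷es ∷ AllPairs.tail f∷g∷es))
                          (pairwiseCobiclique⇒inBiclique f (g ∷ es) f∷g∷es)

    module _ {k} (C : Fin k → Edge → Set) (cliques : ∀ i → IsCliqueL (C i))
             (meet : ∀ i j → ∃ λ e → C i e × C j e) where

      anchor : Fin k → Fin k → Edge
      anchor i j = proj₁ (meet i j)

      anchors : Fin k → List Edge
      anchors i = tabulate (anchor i) ++ tabulate (flip anchor i)

      anchors⊆C : ∀ i → All (C i) (anchors i)
      anchors⊆C i = ++⁺ (tabulate⁺ λ j → proj₁ (proj₂ (meet i j)))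
                        (tabulate⁺ λ j → proj₂ (proj₂ (meet j i)))

      Anchored : Subset n → Set
      Anchored B = ∃ λ i → IsBiclique B × All (EdgeIn B) (anchors i)

      anchored? : Decidable Anchored
      anchored? B = any? λ i → biclique? B ×-dec All.all? (edgeIn? B) (anchors i)

      anchoredBicliques : List (Subset n)
      anchoredBicliques = filter anchored? (allSubsets n)

      anchored-∈ : Anchored B → B ∈ₗ anchoredBicliques
      anchored-∈ = ∈-filter⁺ anchored? (∈-allSubsets _)

      allAnchored : All Anchored anchoredBicliques
      allAnchored = all-filter anchored? (allSubsets n)

      anchored-meet : Anchored B → Anchored B′ → Meet B B′
      anchored-meet (i , _ , anchorsB) (j , _ , anchorsB′) =
        anchor i j , All.lookup anchorsB (∈-++⁺ˡ (∈-tabulate⁺ j)) ,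
        All.lookup anchorsB′ (∈-++⁺ʳ (tabulate (anchor j)) (∈-tabulate⁺ i))

      anchoredThrough : ∀ i → C i f → ∃ λ B → Anchored B × EdgeIn B f
      anchoredThrough {f = f} i cf =
        let B , bic , f∷anchorsB =
              pairwiseCobiclique⇒inBiclique f (anchors i)
                (all⇒allPairs (complete⇒cobiclique (proj₁ (proj₂ (cliques i)))) (cf ∷ anchors⊆C i))
        in B , (i , bic , All.tail f∷anchorsB) , All.head f∷anchorsB

      commonEdge : Fin k → ∃ λ h → ∀ i → C i h
      commonEdge i₀ =
        let _ , a₀ , _ = anchoredThrough i₀ (proj₁ (proj₂ (meet i₀ i₀)))
            h , h∈anchored = helly-bicliques anchoredBicliques (∈⇒≢[] (anchored-∈ a₀))
                               (All.map (proj₁ ∘ proj₂) allAnchored)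
                               (All.map (λ a → All.map (anchored-meet a) allAnchored) allAnchored)
        in h , λ i → clique-absorbs (cliques i) λ cf ¬same →
             let B , a , fB = anchoredThrough i cf
             in ¬same , B , proj₁ (proj₂ a) , fB , All.lookup h∈anchored (anchored-∈ a)

  ebHelly⇒klHelly : EBHelly G → KLHelly G
  ebHelly⇒klHelly ebHelly []          ne _       _     = contradiction refl ne
  ebHelly⇒klHelly ebHelly Cs@(_ ∷ _) _  cliques meets =
    let h , h∈C = commonEdge ebHelly (lookup Cs) (λ i → All.lookup cliques (∈-lookup i))
                    (λ i j → All.lookup (All.lookup meets (∈-lookup i)) (∈-lookup j)) zero
    in h , subst (All (λ C → C h)) (tabulate-lookup Cs) (tabulate⁺ {f = lookup Cs} h∈C)

  klHelly⇒ebHelly : KLHelly G → EBHelly G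
  klHelly⇒ebHelly klHelly Fs ne hyperedges meets =
    klHelly Fs ne (All.map ebHyperedge⇒clique hyperedges) meets

theorem8 : (G : Graph) → (EBHelly G → KLHelly G) × (KLHelly G → EBHelly G)
theorem8 G = ebHelly⇒klHelly G , klHelly⇒ebHelly G
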